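{- Let $A,B$ be an instance of $2$-Max-Duo, let $G=(V,E)$ be the graph constructed from it as described in the context, and let $S(i,i';j,j')$ be any square of $G$. Then: - $N(v_{i,j})=N(v_{i',j'})$; - $N(v_{i,j'})=N(v_{i',j})$; - $N(v_{i,j})\cap N(v_{i,j'})=\emptyset$. Consequently, every vertex of $V$ is adjacent to either none or exactly two of the four vertices of the square.
   Context: $A=(a_1,\dots,a_n)$ and $B=(b_1,\dots,b_n)$ are strings such that $B$ is a permutation of $A$ and every letter occurs at most twice in each of $A$ and $B$. $H=(A,B,F)$ is the bipartite graph with vertex classes $a_1,\dots,a_n$ and $b_1,\dots,b_n$, and an edge $e_{i,j}$ between $a_i$ and $b_j$ if and only if the letters $a_i$ and $b_j$ are equal. $G=(V,E)$ has vertex set $V=\{v_{i,j}: 1\le i,j\le n-1,\ e_{i,j},e_{i+1,j+1}\in F\}$. Two distinct vertices are adjacent if and only if their corresponding pairs of edges $(e_{i,j},e_{i+1,j+1})$ cannot both be contained in a common perfect matching of $H$. $N(v)$ denotes the neighbourhood of $v$ in $G$. For indices $i\ne i'$ and $j\ne j'$ such that the four vertices $v_{i,j},v_{i,j'},v_{i',j},v_{i',j'}$ all belong to $V$, the subgraph of $G$ induced on these four vertices is called a square and is denoted $S(i,i';j,j')$. -}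

module Defs where

open import Data.Nat using (ℕ; suc)
open import Data.Fin using (Fin; inject₁; zero; suc)
open import Data.Fin.Permutation using (Permutation′; _⟨$⟩ʳ_)
open import Data.Product using (Σ; _×_; _,_)
open import Data.Sum using (_⊎_)
open import Data.Empty using (⊥)
open import Relation.Nullary using (¬_)
open import Relation.Binary.PropositionalEquality using (_≡_; _≢_)
open import Function.Bundles using (_⇔_)

Str : Set → ℕ → Set
Str L n = Fin n → L

IsPermOf : {L : Set} {n : ℕ} → Str L n → Str L n → Set
IsPermOf {n = n} B A = Σ (Permutation′ n) λ π → ∀ i → B (π ⟨$⟩ʳ i) ≡ A i

AtMostTwice : {L : Set} {n : ℕ} → Str L n → Set
AtMostTwice A = ∀ i j k → i ≢ j → j ≢ k → i ≢ k → A i ≡ A j → A j ≡ A k → ⊥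

Instance2MD : {L : Set} {n : ℕ} → Str L n → Str L n → Set
Instance2MD A B = IsPermOf B A × AtMostTwice A × AtMostTwice B

-- Perfect matchings of H: bijections σ with a_i = b_{σ(i)}; edge e_{i,j} ∈ σ iff σ(i) = j.
PerfectMatching : {L : Set} {n : ℕ} → Str L n → Str L n → Set
PerfectMatching {n = n} A B = Σ (Permutation′ n) λ σ → ∀ i → A i ≡ B (σ ⟨$⟩ʳ i)

-- Strings have length n = suc m; the index pairs (i,j) range over Fin m,
-- with position i ↦ inject₁ i and position i+1 ↦ suc i.
Idx : ℕ → Set
Idx m = Fin m × Fin m

-- v_{i,j} ∈ V  iff  e_{i,j}, e_{i+1,j+1} ∈ F.
InV : {L : Set} {m : ℕ} → Str L (suc m) → Str L (suc m) → Idx m → Set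
InV A B (i , j) = A (inject₁ i) ≡ B (inject₁ j) × A (suc i) ≡ B (suc j)

Contains : {L : Set} {m : ℕ} {A B : Str L (suc m)} → PerfectMatching A B → Idx m → Set
Contains (σ , _) (i , j) = (σ ⟨$⟩ʳ inject₁ i ≡ inject₁ j) × (σ ⟨$⟩ʳ suc i ≡ suc j)

Adj : {L : Set} {m : ℕ} → Str L (suc m) → Str L (suc m) → Idx m → Idx m → Set
Adj A B v w = v ≢ w × ¬ (Σ (PerfectMatching A B) λ σ → Contains {A = A} {B} σ v × Contains {A = A} {B} σ w)

SameNbhd : {L : Set} {m : ℕ} → Str L (suc m) → Str L (suc m) → Idx m → Idx m → Set
SameNbhd A B v w = ∀ u → InV A B u → (Adj A B v u ⇔ Adj A B w u)

DisjointNbhd : {L : Set} {m : ℕ} → Str L (suc m) → Str L (suc m) → Idx m → Idx m → Set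
DisjointNbhd A B v w = ∀ u → InV A B u → Adj A B v u → Adj A B w u → ⊥

NoneOrExactlyTwo : {L : Set} {m : ℕ} → Str L (suc m) → Str L (suc m) → (Fin 4 → Idx m) → Idx m → Set
NoneOrExactlyTwo A B sq u =
  (∀ r → ¬ Adj A B u (sq r))
  ⊎ Σ (Fin 4) λ p → Σ (Fin 4) λ q → p ≢ q × Adj A B u (sq p) × Adj A B u (sq q)
        × (∀ r → r ≢ p → r ≢ q → ¬ Adj A B u (sq r))

squareVs : {m : ℕ} → Fin m → Fin m → Fin m → Fin m → Fin 4 → Idx m
squareVs i i' j j' zero = (i , j)
squareVs i i' j j' (suc zero) = (i , j')
squareVs i i' j j' (suc (suc zero)) = (i' , j)
squareVs i i' j j' (suc (suc (suc zero))) = (i' , j')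

module Submission where

-- A square
-- S(i,i';j,j') exhibits two letter pairs: x occupies exactly {i,i'} in A and
-- {j,j'} in B, and y ≠ x occupies exactly {i+1,i'+1} and {j+1,j'+1}.  Since
-- every letter occurs at most twice, σ maps each pair either "aligned"
-- (i ↦ j, i' ↦ j') or "flipped" (i ↦ j', i' ↦ j).  Hence σ contains v_{i,j}
-- iff it contains v_{i',j'} (both pairs aligned), and v_{i,j'} iff v_{i',j}
-- (both flipped); vertices contained in the same matchings have the same
-- neighbourhood.  The state of a pair can be changed independently of the
-- rest of σ by composing with a transposition of its two targets; so a
-- vertex u (realised by some σ₀) is compatible with the aligned state iff
-- σ₀ is aligned on every pair that u touches, and likewise for the flipped
-- state.  Finally, if u touches both pairs then σ₀ is aligned on both or
-- flipped on both, so u is compatible with v_{i,j} or with v_{i,j'}; this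
-- covering property yields the disjointness and the "none or two" count.

open import Defs
open import Data.Nat using (ℕ; suc)
open import Data.Fin using (Fin; inject₁; zero; suc)
open import Data.Fin.Properties using (_≟_; inject₁-injective; suc-injective)
open import Data.Fin.Permutation using (_⟨$⟩ʳ_; _⟨$⟩ˡ_; inverseˡ; transpose; _∘ₚ_)
import Data.Fin.Permutation.Components as PC
open import Data.Product using (Σ; _×_; _,_; proj₁; proj₂)
open import Data.Sum using (_⊎_; inj₁; inj₂)
import Data.Sum as Sum
open import Data.Empty using (⊥; ⊥-elim)
open import Function using (_∘_; const)
open import Relation.Nullary using (¬_; yes; no; Dec)
open import Relation.Nullary.Decidable using (_⊎-dec_; _×-dec_; _→-dec_)
import Relation.Nullary.Decidable as Dec
open import Relation.Binary.PropositionalEquality using (_≡_; _≢_; refl; sym; trans; cong; subst; ≢-sym)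
open import Function.Bundles using (_⇔_; mk⇔; Equivalence)
import Function.Properties.Equivalence as ⇔

inject₁≢suc : ∀ {m} (k : Fin m) → inject₁ k ≢ suc k
inject₁≢suc zero    ()
inject₁≢suc (suc k) e = inject₁≢suc k (suc-injective e)

no-2-cycle : ∀ {m} {k x : Fin m} → inject₁ k ≡ suc x → inject₁ x ≡ suc k → ⊥
no-2-cycle {k = suc k} {suc x} e e' = no-2-cycle (suc-injective e) (suc-injective e')

shifted-pair : ∀ {m} {l y z : Fin m} →
  inject₁ l ≡ suc y ⊎ inject₁ l ≡ suc z → suc l ≡ inject₁ y ⊎ suc l ≡ inject₁ z →
  (inject₁ l ≡ suc y × suc l ≡ inject₁ z) ⊎ (inject₁ l ≡ suc z × suc l ≡ inject₁ y)
shifted-pair (inj₁ e) (inj₁ e') = ⊥-elim (no-2-cycle e (sym e'))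
shifted-pair (inj₁ e) (inj₂ e') = inj₁ (e , e')
shifted-pair (inj₂ e) (inj₁ e') = inj₂ (e , e')
shifted-pair (inj₂ e) (inj₂ e') = ⊥-elim (no-2-cycle e (sym e'))

transpose-left : ∀ {n} (c b : Fin n) → PC.transpose c b c ≡ b
transpose-left c b with c ≟ c
... | yes _  = refl
... | no c≢c = ⊥-elim (c≢c refl)

transpose-right : ∀ {n} (c b : Fin n) → PC.transpose c b b ≡ c
transpose-right c b with b ≟ c
... | yes b≡c = b≡c
... | no _ with b ≟ b
...   | yes _  = refl
...   | no b≢b = ⊥-elim (b≢b refl)

transpose-elsewhere : ∀ {n} {c b y : Fin n} → y ≢ c → y ≢ b → PC.transpose c b y ≡ y
transpose-elsewhere {c = c} {b} {y} y≢c y≢b with y ≟ c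
... | yes y≡c = ⊥-elim (y≢c y≡c)
... | no _ with y ≟ b
...   | yes y≡b = ⊥-elim (y≢b y≡b)
...   | no _    = refl

module Matchings {L : Set} {m : ℕ} (A B : Str L (suc m)) where

  Pos : Set
  Pos = Fin (suc m)

  Matching : Set
  Matching = PerfectMatching A B

  at : Matching → Pos → Pos
  at σ x = proj₁ σ ⟨$⟩ʳ x

  at-letter : (σ : Matching) (x : Pos) → A x ≡ B (at σ x)
  at-letter = proj₂

  at-injective : (σ : Matching) {x y : Pos} → at σ x ≡ at σ y → x ≡ y
  at-injective (π , _) {x} {y} e =
    trans (sym (inverseˡ π)) (trans (cong (π ⟨$⟩ˡ_) e) (inverseˡ π))

  edge-along : (σ : Matching) {X X' T T' : Pos} → X ≡ X' → T ≡ T' → at σ X ≡ T → at σ X' ≡ T'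
  edge-along σ refl refl e = e

  transpose-letter : {c b : Pos} → B c ≡ B b → (y : Pos) → B (PC.transpose c b y) ≡ B y
  transpose-letter {c} {b} e y = by-cases (y ≟ c) (y ≟ b)
    where
    by-cases : Dec (y ≡ c) → Dec (y ≡ b) → B (PC.transpose c b y) ≡ B y
    by-cases (yes refl) _        = trans (cong B (transpose-left c b)) (sym e)
    by-cases (no _)     (yes refl) = trans (cong B (transpose-right c b)) e
    by-cases (no y≢c)   (no y≢b)   = cong B (transpose-elsewhere y≢c y≢b)

  retarget : (c b : Pos) → B c ≡ B b → Matching → Matching
  retarget c b e σ =
    (proj₁ σ ∘ₚ transpose c b) , λ x → trans (at-letter σ x) (sym (transpose-letter e (at σ x)))

  two-edges : Matching → {a a' b b' : Pos} → a ≢ a' → b ≢ b' → A a ≡ B b → A a' ≡ B b' →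
    Σ Matching λ τ → at τ a ≡ b × at τ a' ≡ b'
  two-edges σ {a} {a'} {b} {b'} a≢a' b≢b' e e' = τ , τa , transpose-left (at σ₁ a') b'
    where
    σ₁ = retarget (at σ a) b (trans (sym (at-letter σ a)) e) σ
    σ₁a : at σ₁ a ≡ b
    σ₁a = transpose-left (at σ a) b
    τ = retarget (at σ₁ a') b' (trans (sym (at-letter σ₁ a')) e') σ₁
    τa : at τ a ≡ b
    τa = trans (cong (PC.transpose (at σ₁ a') b') σ₁a)
               (transpose-elsewhere (λ b≡ → a≢a' (at-injective σ₁ (trans σ₁a b≡))) b≢b')

  permutation-matching : IsPermOf B A → Matching
  permutation-matching (π , ok) = π , λ x → sym (ok x)

  InSomeMatching : Idx m → Set
  InSomeMatching v = Σ Matching λ σ → Contains {A = A} {B} σ v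

  vertex-in-matching : IsPermOf B A → ∀ {v} → InV A B v → InSomeMatching v
  vertex-in-matching perm {k , l} (e , e') =
    two-edges (permutation-matching perm) (inject₁≢suc k) (inject₁≢suc l) e e'

  Compatible : Idx m → Idx m → Set
  Compatible v w = Σ Matching λ σ → Contains {A = A} {B} σ v × Contains {A = A} {B} σ w

  compatible-sym : ∀ {v w} → Compatible v w → Compatible w v
  compatible-sym (σ , cv , cw) = σ , cw , cv

  incompatible⇒adjacent : ∀ {v w} → InSomeMatching w → ¬ Compatible v w → Adj A B v w
  incompatible⇒adjacent (σ , cw) ¬c = (λ { refl → ¬c (σ , cw , cw) }) , ¬c

  SameMatchings : Idx m → Idx m → Set
  SameMatchings v w = ∀ σ → Contains {A = A} {B} σ v ⇔ Contains {A = A} {B} σ w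

  transfer : ∀ {v w u} → SameMatchings v w → Compatible v u → Compatible w u
  transfer same (σ , cv , cu) = σ , Equivalence.to (same σ) cv , cu

  transfer⁻ : ∀ {v w u} → SameMatchings v w → Compatible w u → Compatible v u
  transfer⁻ same = transfer (⇔.sym ∘ same)

  same-nbhd : ∀ {v w} → InSomeMatching v → SameMatchings v w → SameNbhd A B v w
  same-nbhd {v} {w} (σ , cv) same u _ = mk⇔ forward backward
    where
    forward : Adj A B v u → Adj A B w u
    forward (_ , ¬c) = (λ { refl → ¬c (σ , cv , Equivalence.to (same σ) cv) }) , ¬c ∘ transfer⁻ same
    backward : Adj A B w u → Adj A B v u
    backward (_ , ¬c) = (λ { refl → ¬c (σ , Equivalence.to (same σ) cv , cv) }) , ¬c ∘ transfer same

  disjoint-nbhd : ∀ {v w} → (∀ u → InV A B u → Compatible v u ⊎ Compatible w u) →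
    DisjointNbhd A B v w
  disjoint-nbhd cover u hu (_ , ¬cv) (_ , ¬cw) = Sum.[ ¬cv , ¬cw ] (cover u hu)

  -- Four vertices forming two classes {0,3} and {1,2} of equal matchings, such that
  -- u is compatible with one of the classes: u sees either none or one class.
  none-or-two : (sq : Fin 4 → Idx m) →
    InSomeMatching (sq zero) → InSomeMatching (sq (suc zero)) →
    SameMatchings (sq zero) (sq (suc (suc (suc zero)))) →
    SameMatchings (sq (suc zero)) (sq (suc (suc zero))) →
    ∀ u → Dec (Compatible (sq zero) u) → Dec (Compatible (sq (suc zero)) u) →
    Compatible (sq zero) u ⊎ Compatible (sq (suc zero)) u →
    NoneOrExactlyTwo A B sq u
  none-or-two sq (σ₀ , c₀) (σ₁ , c₁) same₀₃ same₁₂ u c0? c1? cover with c0? | c1?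
  ... | yes c0 | yes c1 = inj₁ λ where
        zero                   (_ , ¬c) → ¬c (compatible-sym c0)
        (suc zero)             (_ , ¬c) → ¬c (compatible-sym c1)
        (suc (suc zero))       (_ , ¬c) → ¬c (compatible-sym (transfer same₁₂ c1))
        (suc (suc (suc zero))) (_ , ¬c) → ¬c (compatible-sym (transfer same₀₃ c0))
  ... | yes c0 | no ¬c1 =
        inj₂ (suc zero , suc (suc zero) , (λ ())
             , incompatible⇒adjacent (σ₁ , c₁) (¬c1 ∘ compatible-sym)
             , incompatible⇒adjacent (σ₁ , Equivalence.to (same₁₂ σ₁) c₁)
                                     (¬c1 ∘ transfer⁻ same₁₂ ∘ compatible-sym)
             , λ where
                 zero                   _ _ (_ , ¬c) → ¬c (compatible-sym c0)
                 (suc zero)             r≢1 _ _ → r≢1 refl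
                 (suc (suc zero))       _ r≢2 _ → r≢2 refl
                 (suc (suc (suc zero))) _ _ (_ , ¬c) → ¬c (compatible-sym (transfer same₀₃ c0)))
  ... | no ¬c0 | yes c1 =
        inj₂ (zero , suc (suc (suc zero)) , (λ ())
             , incompatible⇒adjacent (σ₀ , c₀) (¬c0 ∘ compatible-sym)
             , incompatible⇒adjacent (σ₀ , Equivalence.to (same₀₃ σ₀) c₀)
                                     (¬c0 ∘ transfer⁻ same₀₃ ∘ compatible-sym)
             , λ where
                 zero                   r≢0 _ _ → r≢0 refl
                 (suc zero)             _ _ (_ , ¬c) → ¬c (compatible-sym c1)
                 (suc (suc zero))       _ _ (_ , ¬c) → ¬c (compatible-sym (transfer same₁₂ c1))
                 (suc (suc (suc zero))) _ r≢3 _ → r≢3 refl)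
  ... | no ¬c0 | no ¬c1 = ⊥-elim (Sum.[ ¬c0 , ¬c1 ] cover)

  record LetterPair : Set where
    field
      a a' b b' : Pos
      a≢a'      : a ≢ a'
      b≢b'      : b ≢ b'
      ab        : A a ≡ B b
      ab'       : A a ≡ B b'
      a'b       : A a' ≡ B b
      a'b'      : A a' ≡ B b'
  open LetterPair

  flip : LetterPair → LetterPair
  flip P = record { a = a P ; a' = a' P ; b = b' P ; b' = b P
                  ; a≢a' = a≢a' P ; b≢b' = ≢-sym (b≢b' P)
                  ; ab = ab' P ; ab' = ab P ; a'b = a'b' P ; a'b' = a'b P }

  -- σ maps the pair straight (a ↦ b); aligned on flip P means crossed (a ↦ b').
  Aligned : LetterPair → Matching → Set
  Aligned P σ = at σ (a P) ≡ b P

  aligned? : (P : LetterPair) (σ : Matching) → Dec (Aligned P σ)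
  aligned? P σ = at σ (a P) ≟ b P

  Target : LetterPair → Pos → Set
  Target P q = q ≡ b P ⊎ q ≡ b' P

  Touches : LetterPair → Pos → Pos → Set
  Touches P T₁ T₂ = Target P T₁ ⊎ Target P T₂

  touches? : ∀ P T₁ T₂ → Dec (Touches P T₁ T₂)
  touches? P T₁ T₂ = ((T₁ ≟ b P) ⊎-dec (T₁ ≟ b' P)) ⊎-dec ((T₂ ≟ b P) ⊎-dec (T₂ ≟ b' P))

  touches-unflip : ∀ P {T₁ T₂} → Touches (flip P) T₁ T₂ → Touches P T₁ T₂
  touches-unflip P = Sum.map Sum.swap Sum.swap

  DifferentLetters : LetterPair → LetterPair → Set
  DifferentLetters P Q = A (a P) ≢ A (a Q)

  module Pairs (twA : AtMostTwice A) (twB : AtMostTwice B) (P : LetterPair) where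

    target-letter : ∀ {q} → Target P q → B q ≡ A (a P)
    target-letter (inj₁ refl) = sym (ab P)
    target-letter (inj₂ refl) = sym (ab' P)

    only-sources : ∀ x → A x ≡ A (a P) → x ≡ a P ⊎ x ≡ a' P
    only-sources x e with x ≟ a P | x ≟ a' P
    ... | yes x≡a | _      = inj₁ x≡a
    ... | no _    | yes x≡a' = inj₂ x≡a'
    ... | no x≢a  | no x≢a' =
          ⊥-elim (twA x (a P) (a' P) x≢a (a≢a' P) x≢a' e (trans (ab P) (sym (a'b P))))

    only-targets : ∀ q → B q ≡ A (a P) → Target P q
    only-targets q e with q ≟ b P | q ≟ b' P
    ... | yes q≡b | _       = inj₁ q≡b
    ... | no _    | yes q≡b' = inj₂ q≡b'
    ... | no q≢b  | no q≢b' =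
          ⊥-elim (twB q (b P) (b' P) q≢b (b≢b' P) q≢b' (trans e (ab P)) (trans (sym (ab P)) (ab' P)))

    image-target : (σ : Matching) (x : Pos) → A x ≡ A (a P) → Target P (at σ x)
    image-target σ x e = only-targets (at σ x) (trans (sym (at-letter σ x)) e)

    edge-source : (σ : Matching) {x q : Pos} → at σ x ≡ q → Target P q → x ≡ a P ⊎ x ≡ a' P
    edge-source σ {x} e t = only-sources x (trans (at-letter σ x) (trans (cong B e) (target-letter t)))

    aligned-or-flipped : (σ : Matching) → Aligned P σ ⊎ Aligned (flip P) σ
    aligned-or-flipped σ = image-target σ (a P) refl

    aligned⇒partner : (σ : Matching) → Aligned P σ → at σ (a' P) ≡ b' P
    aligned⇒partner σ al with image-target σ (a' P) (sym (trans (ab P) (sym (a'b P))))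
    ... | inj₁ e = ⊥-elim (a≢a' P (at-injective σ (trans al (sym e))))
    ... | inj₂ e = e

    partner⇒aligned : (σ : Matching) → at σ (a' P) ≡ b' P → Aligned P σ
    partner⇒aligned σ e with aligned-or-flipped σ
    ... | inj₁ al = al
    ... | inj₂ fl = ⊥-elim (a≢a' P (at-injective σ (trans fl (sym e))))

    rigid : (σ τ : Matching) {X T : Pos} → at σ X ≡ T → at τ X ≡ T → Target P T →
      Aligned P σ → Aligned P τ
    rigid σ τ eσ eτ (inj₁ refl) al =
      trans (cong (at τ) (at-injective σ (trans al (sym eσ)))) eτ
    rigid σ τ eσ eτ (inj₂ refl) al =
      partner⇒aligned τ (trans (cong (at τ) (at-injective σ (trans (aligned⇒partner σ al) (sym eσ)))) eτ)

    rigid-touching : (σ τ : Matching) {X₁ T₁ X₂ T₂ : Pos} →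
      at σ X₁ ≡ T₁ → at σ X₂ ≡ T₂ → at τ X₁ ≡ T₁ → at τ X₂ ≡ T₂ →
      Aligned P σ → Touches P T₁ T₂ → Aligned P τ
    rigid-touching σ τ σ₁ _ τ₁ _ al (inj₁ t) = rigid σ τ σ₁ τ₁ t al
    rigid-touching σ τ _ σ₂ _ τ₂ al (inj₂ t) = rigid σ τ σ₂ τ₂ t al

    realign : Matching → Matching
    realign σ with aligned? P σ
    ... | yes _ = σ
    ... | no _  = retarget (b P) (b' P) (trans (sym (ab P)) (ab' P)) σ

    realign-aligned : (σ : Matching) → Aligned P (realign σ)
    realign-aligned σ with aligned? P σ
    ... | yes al = al
    ... | no ¬al with aligned-or-flipped σ
    ...   | inj₁ al = ⊥-elim (¬al al)
    ...   | inj₂ fl = trans (cong (PC.transpose (b P) (b' P)) fl) (transpose-right (b P) (b' P))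

    realign-agrees : (σ : Matching) (x : Pos) → (Target P (at σ x) → Aligned P σ) →
      at (realign σ) x ≡ at σ x
    realign-agrees σ x h with aligned? P σ
    ... | yes _  = refl
    ... | no ¬al = transpose-elsewhere (¬al ∘ h ∘ inj₁) (¬al ∘ h ∘ inj₂)

    realign-keeps-edge : (σ : Matching) {X T : Pos} → at σ X ≡ T → (Target P T → Aligned P σ) →
      at (realign σ) X ≡ T
    realign-keeps-edge σ {X} e h = trans (realign-agrees σ X (h ∘ subst (Target P) e)) e

    -- Pairs with different letters have disjoint targets, so realigning P keeps Q aligned.
    realign-keeps-aligned : ∀ Q → DifferentLetters P Q → (σ : Matching) →
      Aligned Q σ → Aligned Q (realign σ)
    realign-keeps-aligned Q P≢Q σ al =
      trans (realign-agrees σ (a Q) λ t → ⊥-elim (P≢Q (trans (sym (target-letter t))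
                                                              (trans (cong B al) (sym (ab Q))))))
            al

  Forced : LetterPair → LetterPair → Pos → Pos → Matching → Set
  Forced P Q T₁ T₂ σ = (Touches P T₁ T₂ → Aligned P σ) × (Touches Q T₁ T₂ → Aligned Q σ)

  forced? : ∀ P Q T₁ T₂ σ → Dec (Forced P Q T₁ T₂ σ)
  forced? P Q T₁ T₂ σ = (touches? P T₁ T₂ →-dec aligned? P σ) ×-dec (touches? Q T₁ T₂ →-dec aligned? Q σ)

  Realisable : LetterPair → LetterPair → Pos → Pos → Pos → Pos → Set
  Realisable P Q X₁ T₁ X₂ T₂ =
    Σ Matching λ τ → (Aligned P τ × Aligned Q τ) × (at τ X₁ ≡ T₁ × at τ X₂ ≡ T₂)

  module TwoPairs (twA : AtMostTwice A) (twB : AtMostTwice B)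
    (P Q : LetterPair) (P≢Q : DifferentLetters P Q)
    {X₁ T₁ X₂ T₂ : Pos} (σ : Matching) (e₁ : at σ X₁ ≡ T₁) (e₂ : at σ X₂ ≡ T₂) where

    private
      module P = Pairs twA twB P
      module Q = Pairs twA twB Q

    -- Realign P, then Q; each step keeps the edges and the earlier alignment.
    realise : Forced P Q T₁ T₂ σ → Realisable P Q X₁ T₁ X₂ T₂
    realise (fP , fQ) =
      τ , (Q.realign-keeps-aligned P (≢-sym P≢Q) σ₁ (P.realign-aligned σ) , Q.realign-aligned σ₁)
        , (Q.realign-keeps-edge σ₁ e₁' (fQ' ∘ inj₁) , Q.realign-keeps-edge σ₁ e₂' (fQ' ∘ inj₂))
      where
      σ₁ = P.realign σ
      τ  = Q.realign σ₁
      e₁' : at σ₁ X₁ ≡ T₁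
      e₁' = P.realign-keeps-edge σ e₁ (fP ∘ inj₁)
      e₂' : at σ₁ X₂ ≡ T₂
      e₂' = P.realign-keeps-edge σ e₂ (fP ∘ inj₂)
      fQ' : Touches Q T₁ T₂ → Aligned Q σ₁
      fQ' = P.realign-keeps-aligned Q P≢Q σ ∘ fQ

    -- Conversely a touched pair has the same state in every matching containing the edges.
    necessary : Realisable P Q X₁ T₁ X₂ T₂ → Forced P Q T₁ T₂ σ
    necessary (τ , (alP , alQ) , (τ₁ , τ₂)) =
      P.rigid-touching τ σ τ₁ τ₂ e₁ e₂ alP , Q.rigid-touching τ σ τ₁ τ₂ e₁ e₂ alQ

    -- Hence realisability is decided by inspecting σ alone.
    realisable? : Dec (Realisable P Q X₁ T₁ X₂ T₂)
    realisable? = Dec.map′ realise necessary (forced? P Q T₁ T₂ σ)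

    forced-either :
      (Touches P T₁ T₂ → Touches Q T₁ T₂ →
         (Aligned P σ × Aligned Q σ) ⊎ (Aligned (flip P) σ × Aligned (flip Q) σ)) →
      Forced P Q T₁ T₂ σ ⊎ Forced (flip P) (flip Q) T₁ T₂ σ
    forced-either uniform with touches? P T₁ T₂ | touches? Q T₁ T₂
    ... | yes tP | yes tQ = Sum.map (λ (alP , alQ) → const alP , const alQ)
                                    (λ (flP , flQ) → const flP , const flQ) (uniform tP tQ)
    ... | yes _  | no ¬tQ = Sum.map (λ alP → const alP , ⊥-elim ∘ ¬tQ)
                                    (λ flP → const flP , ⊥-elim ∘ ¬tQ ∘ touches-unflip Q)
                                    (P.aligned-or-flipped σ)
    ... | no ¬tP | yes _  = Sum.map (λ alQ → ⊥-elim ∘ ¬tP , const alQ)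
                                    (λ flQ → ⊥-elim ∘ ¬tP ∘ touches-unflip P , const flQ)
                                    (Q.aligned-or-flipped σ)
    ... | no ¬tP | no ¬tQ = inj₁ (⊥-elim ∘ ¬tP , ⊥-elim ∘ ¬tQ)

module Square {L : Set} {m : ℕ} (A B : Str L (suc m)) (inst : Instance2MD A B)
  (i i' j j' : Fin m) (i≢i' : i ≢ i') (j≢j' : j ≢ j')
  (v₁ : InV A B (i , j)) (v₂ : InV A B (i , j')) (v₃ : InV A B (i' , j)) (v₄ : InV A B (i' , j'))
  where

  open Matchings A B
  open LetterPair

  perm : IsPermOf B A
  perm = proj₁ inst

  twA : AtMostTwice A
  twA = proj₁ (proj₂ inst)

  twB : AtMostTwice B
  twB = proj₂ (proj₂ inst)

  P : LetterPair
  P = record { a = inject₁ i ; a' = inject₁ i' ; b = inject₁ j ; b' = inject₁ j'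
             ; a≢a' = i≢i' ∘ inject₁-injective ; b≢b' = j≢j' ∘ inject₁-injective
             ; ab = proj₁ v₁ ; ab' = proj₁ v₂ ; a'b = proj₁ v₃ ; a'b' = proj₁ v₄ }

  Q : LetterPair
  Q = record { a = suc i ; a' = suc i' ; b = suc j ; b' = suc j'
             ; a≢a' = i≢i' ∘ suc-injective ; b≢b' = j≢j' ∘ suc-injective
             ; ab = proj₂ v₁ ; ab' = proj₂ v₂ ; a'b = proj₂ v₃ ; a'b' = proj₂ v₄ }

  module P  = Pairs twA twB P
  module Q  = Pairs twA twB Q
  module P̃ = Pairs twA twB (flip P)
  module Q̃ = Pairs twA twB (flip Q)

  -- x ≠ y: otherwise three distinct positions among i, i', i+1, i'+1 carry x.
  x≢y : DifferentLetters P Q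
  x≢y x≡y with inject₁ i' ≟ suc i
  ... | no i'≢i+1 = twA (inject₁ i') (inject₁ i) (suc i) (≢-sym (a≢a' P)) (inject₁≢suc i) i'≢i+1
                        (trans (proj₁ v₃) (sym (proj₁ v₁))) x≡y
  ... | yes i'≡i+1 = twA (inject₁ i) (suc i) (suc i') (inject₁≢suc i) (a≢a' Q) (no-2-cycle i'≡i+1)
                         x≡y (trans (proj₂ v₁) (sym (proj₂ v₃)))

  -- v_{i,j} and v_{i',j'} both say "P and Q aligned"; v_{i,j'} and v_{i',j} "both flipped".
  same-straight : SameMatchings (i , j) (i' , j')
  same-straight σ = mk⇔ (λ (alP , alQ) → P.aligned⇒partner σ alP , Q.aligned⇒partner σ alQ)
                        (λ (eP , eQ) → P.partner⇒aligned σ eP , Q.partner⇒aligned σ eQ)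

  same-crossed : SameMatchings (i , j') (i' , j)
  same-crossed σ = mk⇔ (λ (flP , flQ) → P̃.aligned⇒partner σ flP , Q̃.aligned⇒partner σ flQ)
                       (λ (eP , eQ) → P̃.partner⇒aligned σ eP , Q̃.partner⇒aligned σ eQ)

  -- σ treats the two letters of the square alike.
  Uniform : Matching → Set
  Uniform σ = Contains {A = A} {B} σ (i , j) ⊎ Contains {A = A} {B} σ (i , j')

  uniform-at-vertex : ∀ σ {k l} → Contains {A = A} {B} σ (k , l) →
    k ≡ i ⊎ k ≡ i' → l ≡ j ⊎ l ≡ j' → Uniform σ
  uniform-at-vertex σ c (inj₁ refl) (inj₁ refl) = inj₁ c
  uniform-at-vertex σ c (inj₁ refl) (inj₂ refl) = inj₂ c
  uniform-at-vertex σ c (inj₂ refl) (inj₁ refl) = inj₂ (Equivalence.from (same-crossed σ) c)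
  uniform-at-vertex σ c (inj₂ refl) (inj₂ refl) = inj₁ (Equivalence.from (same-straight σ) c)

  -- A vertex whose first edge lies in class y and second edge in class x:
  -- both its edges cross between the two halves of the square, again uniformly.
  uniform-shifted : ∀ σ {k l} → Contains {A = A} {B} σ (k , l) →
    (inject₁ k ≡ suc i × suc k ≡ inject₁ i') ⊎ (inject₁ k ≡ suc i' × suc k ≡ inject₁ i) →
    (inject₁ l ≡ suc j × suc l ≡ inject₁ j') ⊎ (inject₁ l ≡ suc j' × suc l ≡ inject₁ j) →
    Uniform σ
  uniform-shifted σ (c₁ , c₂) (inj₁ (k₁ , k₂)) (inj₁ (l₁ , l₂)) =
    inj₁ (P.partner⇒aligned σ (edge-along σ k₂ l₂ c₂) , edge-along σ k₁ l₁ c₁)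
  uniform-shifted σ (c₁ , c₂) (inj₁ (k₁ , k₂)) (inj₂ (l₁ , l₂)) =
    inj₂ (P̃.partner⇒aligned σ (edge-along σ k₂ l₂ c₂) , edge-along σ k₁ l₁ c₁)
  uniform-shifted σ (c₁ , c₂) (inj₂ (k₁ , k₂)) (inj₁ (l₁ , l₂)) =
    inj₂ (edge-along σ k₂ l₂ c₂ , Q̃.partner⇒aligned σ (edge-along σ k₁ l₁ c₁))
  uniform-shifted σ (c₁ , c₂) (inj₂ (k₁ , k₂)) (inj₂ (l₁ , l₂)) =
    inj₁ (edge-along σ k₂ l₂ c₂ , Q.partner⇒aligned σ (edge-along σ k₁ l₁ c₁))

  uniform-touching : ∀ σ {k l} → Contains {A = A} {B} σ (k , l) →
    Touches P (inject₁ l) (suc l) → Touches Q (inject₁ l) (suc l) → Uniform σ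
  uniform-touching σ c (inj₁ tP) _ =
    uniform-at-vertex σ c (Sum.map inject₁-injective inject₁-injective (P.edge-source σ (proj₁ c) tP))
                        (Sum.map inject₁-injective inject₁-injective tP)
  uniform-touching σ c (inj₂ _) (inj₂ tQ) =
    uniform-at-vertex σ c (Sum.map suc-injective suc-injective (Q.edge-source σ (proj₂ c) tQ))
                        (Sum.map suc-injective suc-injective tQ)
  uniform-touching σ c (inj₂ tP) (inj₁ tQ) =
    uniform-shifted σ c (shifted-pair (Q.edge-source σ (proj₁ c) tQ) (P.edge-source σ (proj₂ c) tP))
                        (shifted-pair tQ tP)

  straight-in-matching : InSomeMatching (i , j)
  straight-in-matching = vertex-in-matching perm v₁

  crossed-in-matching : InSomeMatching (i , j')
  crossed-in-matching = vertex-in-matching perm v₂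

  module Against {u : Idx m} (hu : InV A B u) where
    private
      σ₀ = proj₁ (vertex-in-matching perm hu)
      c₀ = proj₂ (vertex-in-matching perm hu)
      module S = TwoPairs twA twB P Q x≢y σ₀ (proj₁ c₀) (proj₂ c₀)
      module C = TwoPairs twA twB (flip P) (flip Q) x≢y σ₀ (proj₁ c₀) (proj₂ c₀)

    straight? : Dec (Compatible (i , j) u)
    straight? = S.realisable?

    crossed? : Dec (Compatible (i , j') u)
    crossed? = C.realisable?

    straight-or-crossed : Compatible (i , j) u ⊎ Compatible (i , j') u
    straight-or-crossed = Sum.map S.realise C.realise (S.forced-either (uniform-touching σ₀ c₀))

lemma2p4 : {L : Set} {m : ℕ} (A B : Str L (suc m)) → Instance2MD A B →
    (i i' j j' : Fin m) → i ≢ i' → j ≢ j' →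
    InV A B (i , j) → InV A B (i , j') → InV A B (i' , j) → InV A B (i' , j') →
    SameNbhd A B (i , j) (i' , j')
    × SameNbhd A B (i , j') (i' , j)
    × DisjointNbhd A B (i , j) (i , j')
    × (∀ u → InV A B u →
         NoneOrExactlyTwo A B
           (squareVs i i' j j')
           u)
lemma2p4 A B inst i i' j j' i≢i' j≢j' v₁ v₂ v₃ v₄ =
    same-nbhd straight-in-matching same-straight
  , same-nbhd crossed-in-matching same-crossed
  , disjoint-nbhd (λ _ hu → Against.straight-or-crossed hu)
  , λ u hu → none-or-two (squareVs i i' j j') straight-in-matching crossed-in-matching
                         same-straight same-crossed u
                         (Against.straight? hu) (Against.crossed? hu) (Against.straight-or-crossed hu)
  where
  open Matchings A B
  open Square A B inst i i' j j' i≢i' j≢j' v₁ v₂ v₃ v₄
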